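{- Let $\Gamma$ be an ultraconservative constraint language over a finite domain $D$ and let $R\in\langle\Gamma\rangle$ be an $n$-ary relation with $|R|=2$. Then there exists $R'\in\langle\Gamma\rangle_{\nexists}$ such that $|R'|=2$ and $\mathrm{pr}_{1,\dots,n}(R')=R$.
   Context: A constraint language over $D$ is a finite set of relations over $D$; $\Gamma$ is ultraconservative if it contains every unary relation over $D$. $\langle\Gamma\rangle$ is the set of relations definable by primitive positive formulas $\exists\bar y.\,R_1(\mathbf{x_1})\wedge\dots\wedge R_m(\mathbf{x_m})$ with $R_i\in\Gamma\cup\{\{(x,x)\mid x\in D\}\}$; $\langle\Gamma\rangle_{\nexists}$ is the set of relations definable by such formulas without existential quantifiers. For a relation $R'$ of arity $\ge n$, $\mathrm{pr}_{1,\dots,n}(R')=\{(t[1],\dots,t[n])\mid t\in R'\}$. -}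

module Defs where

open import Data.Nat using (ℕ; zero; suc; _+_)
open import Data.Fin using (Fin)
open import Data.Bool using (Bool; true)
open import Data.Vec using (Vec; []; _∷_; lookup; map; _++_; take)
open import Data.List using (List; length)
open import Data.List.Relation.Unary.All using (All)
open import Data.List.Relation.Unary.Any using (Any)
open import Data.Product using (Σ; ∃; _×_; _,_; proj₁; proj₂)
open import Data.Sum using (_⊎_)
open import Data.Empty using (⊥)
open import Relation.Binary.PropositionalEquality using (_≡_; _≢_)
open import Function.Bundles using (_⇔_)

-- The finite domain D is Fin d.  A k-ary relation over D is a decidable
-- subset of D^k, given by its characteristic function.
Rel : ℕ → ℕ → Set
Rel d k = Vec (Fin d) k → Bool

Lang : ℕ → Set
Lang d = List (Σ ℕ (Rel d))

arity : ∀ {d} (Γ : Lang d) → Fin (length Γ) → ℕ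
arity Γ i = proj₁ (Data.List.lookup Γ i)

relOf : ∀ {d} (Γ : Lang d) (i : Fin (length Γ)) → Rel d (arity Γ i)
relOf Γ i = proj₂ (Data.List.lookup Γ i)

IsUnary : ∀ {d} → Rel d 1 → Σ ℕ (Rel d) → Set
IsUnary U (suc zero , S) = ∀ t → S t ≡ U t
IsUnary U (_ , _) = ⊥

Ultraconservative : ∀ {d} → Lang d → Set
Ultraconservative {d} Γ = (U : Rel d 1) → Any (IsUnary U) Γ

data Atom {d} (Γ : Lang d) (m : ℕ) : Set where
  rel : (i : Fin (length Γ)) → Vec (Fin m) (arity Γ i) → Atom Γ m
  eq  : Fin m → Fin m → Atom Γ m

HoldsAtom : ∀ {d} {Γ : Lang d} {m} → Vec (Fin d) m → Atom Γ m → Set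
HoldsAtom {Γ = Γ} σ (rel i xs) = relOf Γ i (map (lookup σ) xs) ≡ true
HoldsAtom σ (eq x y) = lookup σ x ≡ lookup σ y

-- A primitive positive formula with n free variables x₁..xₙ and e
-- existentially quantified variables y₁..yₑ: ∃ȳ. A₁ ∧ … ∧ Aₘ, where the
-- variables of the atoms are x₁..xₙ,y₁..yₑ (indices 0..n-1 free, n..n+e-1 bound).
record PPFormula {d} (Γ : Lang d) (n : ℕ) : Set where
  constructor ppf
  field
    e     : ℕ
    atoms : List (Atom Γ (n + e))

SatPP : ∀ {d} {Γ : Lang d} {n} → PPFormula Γ n → Vec (Fin d) n → Set
SatPP {d} (ppf e atoms) t = ∃ λ (y : Vec (Fin d) e) → All (HoldsAtom (t ++ y)) atoms

SatQF : ∀ {d} {Γ : Lang d} {n} → List (Atom Γ n) → Vec (Fin d) n → Set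
SatQF atoms t = All (HoldsAtom t) atoms

InPPClone : ∀ {d} (Γ : Lang d) {n} → Rel d n → Set
InPPClone Γ {n} R = ∃ λ (φ : PPFormula Γ n) → ∀ t → (R t ≡ true ⇔ SatPP φ t)

InQFClone : ∀ {d} (Γ : Lang d) {n} → Rel d n → Set
InQFClone Γ {n} R = ∃ λ (φ : List (Atom Γ n)) → ∀ t → (R t ≡ true ⇔ SatQF φ t)

HasSize2 : ∀ {d n} → Rel d n → Set
HasSize2 {d} {n} R = ∃ λ (a : Vec (Fin d) n) → ∃ λ (b : Vec (Fin d) n) →
  a ≢ b × (∀ t → (R t ≡ true ⇔ (t ≡ a ⊎ t ≡ b)))

ProjEq : ∀ {d n k} → Rel d (n + k) → Rel d n → Set
ProjEq {d} {n} {k} R' R =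
  ∀ (s : Vec (Fin d) n) → (R s ≡ true ⇔ ∃ λ (t : Vec (Fin d) (n + k)) → R' t ≡ true × take n t ≡ s)

module Submission where

-- Let R ∈ ⟨Γ⟩ be defined by ∃ȳ. φ(x̄, ȳ) and R = {a, b}.  Every solution of
-- the quantifier-free formula φ projects onto a or onto b.  Pick solutions
-- A, B of φ projecting onto a and b, and restrict every variable z to the
-- two values {A[z], B[z]}; this is a unary constraint, hence available in
-- the ultraconservative language Γ.  If the restricted formula has a third
-- solution t, then t lies in the "box" spanned by A and B and projects onto
-- a or b, so it can replace A or B while strictly decreasing the Hamming
-- distance between the two.  After finitely many steps we obtain an
-- isolated pair: the box formula φ ∧ ⋀_z (x_z ∈ {A[z], B[z]}) has exactly
-- the two solutions A and B, and this quantifier-free relation is R'.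

open import Defs
open import Data.Nat using (ℕ; zero; suc; _+_; _≤_; _<_; z≤n; s≤s)
open import Data.Nat.Properties using (≤-trans; m≤n+m; +-monoʳ-≤; +-monoʳ-<)
open import Data.Nat.Induction using (<-wellFounded)
open import Induction.WellFounded using (Acc; acc)
open import Data.Fin using (Fin; zero; suc)
open import Data.Fin.Properties using (any?; all?) renaming (_≟_ to _≟ᶠ_)
open import Data.Bool using (Bool; true; _∨_) renaming (_≟_ to _≟ᵇ_)
open import Data.Vec using (Vec; []; _∷_; lookup; map; take; drop; _++_)
open import Data.Vec.Properties using (take++drop≡id; ++-injectiveˡ; ≡-dec)
open import Data.List using (List; tabulate) renaming (_∷_ to _∷ₗ_; _++_ to _++ₗ_)
open import Data.List.Relation.Unary.All using () renaming (all? to allₗ?)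
open import Data.List.Relation.Unary.All.Properties using (++⁺; ++⁻; tabulate⁺; tabulate⁻)
open import Data.List.Relation.Unary.Any using (Any; here; there)
open import Data.Product using (∃; ∃₂; _×_; _,_; proj₁; proj₂)
open import Data.Sum using (_⊎_; inj₁; inj₂; [_,_]′)
open import Data.Empty using (⊥-elim)
open import Relation.Nullary using (Dec; yes; no; ¬_)
open import Relation.Nullary.Decidable using (⌊_⌋; map′; _×-dec_; _⊎-dec_; ¬?)
open import Level using (0ℓ)
open import Relation.Unary using (Pred; Decidable)
open import Relation.Binary using (DecidableEquality)
open import Relation.Binary.PropositionalEquality using (_≡_; _≢_; refl; sym; trans; cong; cong₂; subst; subst₂)
open import Function.Bundles using (_⇔_; mk⇔; Equivalence)

open Equivalence using (to; from)

_≟ᵥ_ : ∀ {d m} → DecidableEquality (Vec (Fin d) m)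
_≟ᵥ_ = ≡-dec _≟ᶠ_

∃-tuple? : ∀ {d} m {P : Vec (Fin d) m → Set} → Decidable P → Dec (∃ P)
∃-tuple? zero P? = map′ (λ p → [] , p) (λ { ([] , p) → p }) (P? [])
∃-tuple? (suc m) P? =
  map′ (λ (x , t , p) → x ∷ t , p) (λ { (x ∷ t , p) → x , t , p })
       (any? λ x → ∃-tuple? m (λ t → P? (x ∷ t)))

take-++ : ∀ {A : Set} {m k} (xs : Vec A m) (ys : Vec A k) → take m (xs ++ ys) ≡ xs
take-++ {m = m} xs ys = ++-injectiveˡ _ xs (take++drop≡id m (xs ++ ys))

mismatch : ∀ {d} → Fin d → Fin d → ℕ
mismatch x y with x ≟ᶠ y
... | yes _ = 0
... | no  _ = 1

mismatch-self : ∀ {d} (x : Fin d) → mismatch x x ≡ 0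
mismatch-self x with x ≟ᶠ x
... | yes _ = refl
... | no x≢x = ⊥-elim (x≢x refl)

mismatch-distinct : ∀ {d} {x y : Fin d} → x ≢ y → mismatch x y ≡ 1
mismatch-distinct {x = x} {y} x≢y with x ≟ᶠ y
... | yes x≡y = ⊥-elim (x≢y x≡y)
... | no  _ = refl

hamming : ∀ {d m} → Vec (Fin d) m → Vec (Fin d) m → ℕ
hamming [] [] = 0
hamming (x ∷ xs) (y ∷ ys) = mismatch x y + hamming xs ys

Between : ∀ {d m} → Vec (Fin d) m → Vec (Fin d) m → Vec (Fin d) m → Set
Between t A B = ∀ z → lookup t z ≡ lookup A z ⊎ lookup t z ≡ lookup B z

between? : ∀ {d m} (t A B : Vec (Fin d) m) → Dec (Between t A B)
between? t A B = all? λ z → (lookup t z ≟ᶠ lookup A z) ⊎-dec (lookup t z ≟ᶠ lookup B z)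

between-tail : ∀ {d m} {x a b : Fin d} {t A B : Vec (Fin d) m} →
               Between (x ∷ t) (a ∷ A) (b ∷ B) → Between t A B
between-tail bw z = bw (suc z)

hamming-≤ : ∀ {d m} (t A B : Vec (Fin d) m) → Between t A B → hamming t B ≤ hamming A B
hamming-≤ [] [] [] bw = z≤n
hamming-≤ (x ∷ t) (a ∷ A) (b ∷ B) bw with bw zero
... | inj₁ refl = +-monoʳ-≤ (mismatch x b) (hamming-≤ t A B (between-tail bw))
... | inj₂ refl rewrite mismatch-self x =
  ≤-trans (hamming-≤ t A B (between-tail bw)) (m≤n+m _ (mismatch a x))

hamming-<ˡ : ∀ {d m} (t A B : Vec (Fin d) m) → Between t A B → t ≢ A → hamming t B < hamming A B
hamming-<ˡ [] [] [] bw t≢A = ⊥-elim (t≢A refl)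
hamming-<ˡ (x ∷ t) (a ∷ A) (b ∷ B) bw t≢A with x ≟ᶠ a | bw zero
... | yes refl | _ =
  +-monoʳ-< (mismatch x b) (hamming-<ˡ t A B (between-tail bw) (λ t≡A → t≢A (cong (x ∷_) t≡A)))
... | no x≢a | inj₁ x≡a = ⊥-elim (x≢a x≡a)
... | no x≢a | inj₂ refl rewrite mismatch-self x | mismatch-distinct (λ a≡x → x≢a (sym a≡x)) =
  s≤s (hamming-≤ t A B (between-tail bw))

mismatch-sym : ∀ {d} (x y : Fin d) → mismatch x y ≡ mismatch y x
mismatch-sym x y with x ≟ᶠ y | y ≟ᶠ x
... | yes _   | yes _   = refl
... | no  _   | no  _   = refl
... | yes x≡y | no  y≢x = ⊥-elim (y≢x (sym x≡y))
... | no  x≢y | yes y≡x = ⊥-elim (x≢y (sym y≡x))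

hamming-sym : ∀ {d m} (xs ys : Vec (Fin d) m) → hamming xs ys ≡ hamming ys xs
hamming-sym [] [] = refl
hamming-sym (x ∷ xs) (y ∷ ys) = cong₂ _+_ (mismatch-sym x y) (hamming-sym xs ys)

hamming-<ʳ : ∀ {d m} (t A B : Vec (Fin d) m) → Between t A B → t ≢ B → hamming A t < hamming A B
hamming-<ʳ t A B bw t≢B =
  subst₂ _<_ (hamming-sym t A) (hamming-sym B A)
    (hamming-<ˡ t B A (λ z → [ inj₂ , inj₁ ]′ (bw z)) t≢B)

Isolated : ∀ {d m} → Pred (Vec (Fin d) m) 0ℓ → Vec (Fin d) m → Vec (Fin d) m → Set
Isolated P A B = ∀ t → P t → Between t A B → t ≡ A ⊎ t ≡ B

module MinimalPair {d m} (P L Q : Pred (Vec (Fin d) m) 0ℓ) (P? : Decidable P)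
                   (side : ∀ {t} → P t → L t ⊎ Q t) where

  Separated : Vec (Fin d) m → Vec (Fin d) m → Set
  Separated A B = (P A × L A) × (P B × Q B)

  Intruder : Vec (Fin d) m → Vec (Fin d) m → Vec (Fin d) m → Set
  Intruder A B t = P t × Between t A B × t ≢ A × t ≢ B

  intruder? : ∀ A B → Dec (∃ (Intruder A B))
  intruder? A B = ∃-tuple? m λ t →
    P? t ×-dec between? t A B ×-dec ¬? (t ≟ᵥ A) ×-dec ¬? (t ≟ᵥ B)

  no-intruder⇒isolated : ∀ A B → ¬ ∃ (Intruder A B) → Isolated P A B
  no-intruder⇒isolated A B none t pt bt with t ≟ᵥ A | t ≟ᵥ B
  ... | yes t≡A | _       = inj₁ t≡A
  ... | no  _   | yes t≡B = inj₂ t≡B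
  ... | no  t≢A | no  t≢B = ⊥-elim (none (t , pt , bt , t≢A , t≢B))

  -- An intruder replaces the endpoint on its own side; by hamming-<ˡ/ʳ this
  -- decreases the distance, so the recursion is well founded.
  descend : ∀ A B → Acc _<_ (hamming A B) → Separated A B →
            ∃₂ λ A′ B′ → Separated A′ B′ × Isolated P A′ B′
  descend A B (acc smaller) sep with intruder? A B
  ... | no none = A , B , sep , no-intruder⇒isolated A B none
  ... | yes (t , pt , bt , t≢A , t≢B) with side pt
  ...   | inj₁ lt = descend t B (smaller (hamming-<ˡ t A B bt t≢A)) ((pt , lt) , proj₂ sep)
  ...   | inj₂ qt = descend A t (smaller (hamming-<ʳ t A B bt t≢B)) (proj₁ sep , (pt , qt))

  minimal-pair : ∀ A B → Separated A B → ∃₂ λ A′ B′ → Separated A′ B′ × Isolated P A′ B′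
  minimal-pair A B = descend A B (<-wellFounded _)

pairChar : ∀ {A : Set} → DecidableEquality A → A → A → A → Bool
pairChar _≟_ x y t = ⌊ t ≟ x ⌋ ∨ ⌊ t ≟ y ⌋

pairChar-spec : ∀ {A : Set} (_≟_ : DecidableEquality A) (x y t : A) →
                (pairChar _≟_ x y t ≡ true) ⇔ (t ≡ x ⊎ t ≡ y)
pairChar-spec _≟_ x y t with t ≟ x | t ≟ y
... | yes t≡x | _       = mk⇔ (λ _ → inj₁ t≡x) (λ _ → refl)
... | no  _   | yes t≡y = mk⇔ (λ _ → inj₂ t≡y) (λ _ → refl)
... | no  t≢x | no  t≢y = mk⇔ (λ ()) (λ o → ⊥-elim ([ t≢x , t≢y ]′ o))

pairRel : ∀ {d m} → Vec (Fin d) m → Vec (Fin d) m → Rel d m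
pairRel = pairChar _≟ᵥ_

pairUnary : ∀ {d} → Fin d → Fin d → Rel d 1
pairUnary a b (v ∷ []) = pairChar _≟ᶠ_ a b v

holdsAtom? : ∀ {d m} {Γ : Lang d} (σ : Vec (Fin d) m) (α : Atom Γ m) → Dec (HoldsAtom σ α)
holdsAtom? {Γ = Γ} σ (rel i xs) = relOf Γ i (map (lookup σ) xs) ≟ᵇ true
holdsAtom? σ (eq x y) = lookup σ x ≟ᶠ lookup σ y

satQF? : ∀ {d m} {Γ : Lang d} (φ : List (Atom Γ m)) → Decidable (SatQF φ)
satQF? φ t = allₗ? (holdsAtom? t) φ

weaken : ∀ {d m} {ρ} {Γ : Lang d} → Atom Γ m → Atom (ρ ∷ₗ Γ) m
weaken (rel i xs) = rel (suc i) xs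
weaken (eq x y) = eq x y

weaken-spec : ∀ {d m} {ρ} {Γ : Lang d} (σ : Vec (Fin d) m) (α : Atom Γ m) →
              HoldsAtom {Γ = ρ ∷ₗ Γ} σ (weaken α) ⇔ HoldsAtom σ α
weaken-spec σ (rel i xs) = mk⇔ (λ h → h) (λ h → h)
weaken-spec σ (eq x y) = mk⇔ (λ h → h) (λ h → h)

unaryAtom : ∀ {d m} {Γ : Lang d} {U : Rel d 1} → Any (IsUnary U) Γ → Fin m → Atom Γ m
unaryAtom (here {x = suc zero , _} _) z = rel zero (z ∷ [])
unaryAtom (there p) z = weaken (unaryAtom p z)

unaryAtom-spec : ∀ {d m} {Γ : Lang d} {U : Rel d 1} (p : Any (IsUnary U) Γ) (z : Fin m)
                 (σ : Vec (Fin d) m) → HoldsAtom σ (unaryAtom p z) ⇔ (U (lookup σ z ∷ []) ≡ true)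
unaryAtom-spec (here {x = suc zero , _} S≗U) z σ =
  mk⇔ (trans (sym (S≗U _))) (trans (S≗U _))
unaryAtom-spec (there p) z σ =
  mk⇔ (λ h → to (unaryAtom-spec p z σ) (to (weaken-spec σ (unaryAtom p z)) h))
      (λ h → from (weaken-spec σ (unaryAtom p z)) (from (unaryAtom-spec p z σ) h))

boxAtoms : ∀ {d m} {Γ : Lang d} → Ultraconservative Γ →
           Vec (Fin d) m → Vec (Fin d) m → List (Atom Γ m)
boxAtoms ultra A B = tabulate λ z → unaryAtom (ultra (pairUnary (lookup A z) (lookup B z))) z

boxAtoms-spec : ∀ {d m} {Γ : Lang d} (ultra : Ultraconservative Γ) (A B t : Vec (Fin d) m) →
                SatQF (boxAtoms ultra A B) t ⇔ Between t A B
boxAtoms-spec ultra A B t = mk⇔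
  (λ s z → to (pairChar-spec _≟ᶠ_ _ _ _) (to (atom-spec z) (tabulate⁻ s z)))
  (λ bw → tabulate⁺ λ z → from (atom-spec z) (from (pairChar-spec _≟ᶠ_ _ _ _) (bw z)))
  where
  atom-spec : ∀ z → HoldsAtom t (unaryAtom (ultra (pairUnary (lookup A z) (lookup B z))) z) ⇔
                    (pairUnary (lookup A z) (lookup B z) (lookup t z ∷ []) ≡ true)
  atom-spec z = unaryAtom-spec (ultra (pairUnary (lookup A z) (lookup B z))) z t

solution⇒R : ∀ {d n e} {Γ : Lang d} (φ : List (Atom Γ (n + e))) (R : Rel d n) →
             (∀ s → R s ≡ true ⇔ SatPP (ppf e φ) s) → ∀ t → SatQF φ t → R (take n t) ≡ true
solution⇒R {n = n} φ R hφ t s =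
  from (hφ (take n t)) (drop n t , subst (SatQF φ) (sym (take++drop≡id n t)) s)

isolated-pair-definable : ∀ {d m} {Γ : Lang d} → Ultraconservative Γ →
  (φ : List (Atom Γ m)) (A B : Vec (Fin d) m) → SatQF φ A → SatQF φ B →
  Isolated (SatQF φ) A B → InQFClone Γ (pairRel A B)
isolated-pair-definable ultra φ A B sA sB iso =
  φ ++ₗ boxAtoms ultra A B ,
  λ t → mk⇔ (λ r → satisfies t (to (pairChar-spec _≟ᵥ_ A B t) r))
            (λ s → from (pairChar-spec _≟ᵥ_ A B t) (only t (++⁻ φ s)))
  where
  satisfies : ∀ t → t ≡ A ⊎ t ≡ B → SatQF (φ ++ₗ boxAtoms ultra A B) t
  satisfies t (inj₁ refl) = ++⁺ sA (from (boxAtoms-spec ultra A B A) (λ _ → inj₁ refl))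
  satisfies t (inj₂ refl) = ++⁺ sB (from (boxAtoms-spec ultra A B B) (λ _ → inj₂ refl))
  only : ∀ t → SatQF φ t × SatQF (boxAtoms ultra A B) t → t ≡ A ⊎ t ≡ B
  only t (sφ , sbox) = iso t sφ (to (boxAtoms-spec ultra A B t) sbox)

pair-projection : ∀ {d n k} (R : Rel d n) {a b : Vec (Fin d) n} {A B : Vec (Fin d) (n + k)} →
  (∀ s → R s ≡ true ⇔ (s ≡ a ⊎ s ≡ b)) → take n A ≡ a → take n B ≡ b →
  ProjEq (pairRel A B) R
pair-projection R {A = A} {B} hR tA tB s = mk⇔ lift project
  where
  lift : R s ≡ true → ∃ λ t → pairRel A B t ≡ true × take _ t ≡ s
  lift r with to (hR s) r
  ... | inj₁ refl = A , from (pairChar-spec _≟ᵥ_ A B A) (inj₁ refl) , tA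
  ... | inj₂ refl = B , from (pairChar-spec _≟ᵥ_ A B B) (inj₂ refl) , tB
  project : (∃ λ t → pairRel A B t ≡ true × take _ t ≡ s) → R s ≡ true
  project (t , r , refl) with to (pairChar-spec _≟ᵥ_ A B t) r
  ... | inj₁ refl = from (hR _) (inj₁ tA)
  ... | inj₂ refl = from (hR _) (inj₂ tB)

lemma8 : (d : ℕ) (Γ : Lang d) → Ultraconservative Γ →
         (n : ℕ) (R : Rel d n) → InPPClone Γ R → HasSize2 R →
         ∃ λ (k : ℕ) → ∃ λ (R' : Rel d (n + k)) →
           InQFClone Γ R' × HasSize2 R' × ProjEq R' R
lemma8 d Γ ultra n R (ppf e φ , hφ) (a , b , a≢b , hR) =
  e , conclude (minimal-pair (a ++ proj₁ a-ext) (b ++ proj₁ b-ext)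
                 ((proj₂ a-ext , take-++ a _) , (proj₂ b-ext , take-++ b _)))
  where
  side : ∀ {t} → SatQF φ t → take n t ≡ a ⊎ take n t ≡ b
  side {t} s = to (hR (take n t)) (solution⇒R φ R hφ t s)

  open MinimalPair (SatQF φ) (λ t → take n t ≡ a) (λ t → take n t ≡ b) (satQF? φ) side

  a-ext : ∃ λ y → SatQF φ (a ++ y)
  a-ext = to (hφ a) (from (hR a) (inj₁ refl))
  b-ext : ∃ λ y → SatQF φ (b ++ y)
  b-ext = to (hφ b) (from (hR b) (inj₂ refl))

  conclude : (∃₂ λ A B → Separated A B × Isolated (SatQF φ) A B) →
             ∃ λ (R' : Rel d (n + e)) → InQFClone Γ R' × HasSize2 R' × ProjEq R' R
  conclude (A , B , ((sA , tA) , (sB , tB)) , iso) =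
    pairRel A B ,
    isolated-pair-definable ultra φ A B sA sB iso ,
    (A , B , (λ A≡B → a≢b (trans (sym tA) (trans (cong (take n) A≡B) tB))) ,
     pairChar-spec _≟ᵥ_ A B) ,
    pair-projection R hR tA tB
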